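{- Let $n\ge1$ and let $\mathcal{L}_{n-1}$ be the arrangement in $V_{n-1}=\{x\in\mathbb{R}^n:\sum x_i=0\}$ given by $x_i-x_j=1$, $1\le i<j\le n$. For a region $R$ of $\mathcal{L}_{n-1}$ and any point $(x_1,\dots,x_n)\in R$, let $P(R)$ be the poset on $\{1,\dots,n\}$ with $i<_{P} j$ if and only if $i<j$ and $x_i-x_j>1$. Then $R\mapsto P(R)$ is a bijection between the regions of $\mathcal{L}_{n-1}$ and the sleek posets on $\{1,\dots,n\}$. Hence the number of regions of $\mathcal{L}_{n-1}$ equals the number of sleek posets on $\{1,\dots,n\}$.
   Context: A semiorder on $\{1,\dots,n\}$ is a poset $Q$ for which there exist real numbers $y_1,\dots,y_n$ such that $i<_Q j$ if and only if $y_j-y_i>1$. A poset $P$ on $\{1,\dots,n\}$ is sleek if it is the intersection of a semiorder with the chain $1<2<\cdots<n$, i.e. there is a semiorder $Q$ on $\{1,\dots,n\}$ such that $i<_P j$ if and only if $i<_Q j$ and $i<j$.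
   Formalization: Points of $V_{n-1}$ have rational coordinates, and the numbers $y_1,\dots,y_n$ witnessing a semiorder are rational rather than real. -}

module Defs where

open import Level using (0ℓ) renaming (suc to lsuc)
open import Data.Nat using (ℕ; zero; suc)
open import Data.Fin using (Fin; zero; suc) renaming (_<_ to _<ᶠ_)
open import Data.Rational using (ℚ; 0ℚ; 1ℚ; _+_; _-_; _*_; _<_; _≤_)
open import Data.Product using (Σ; _×_; _,_)
open import Relation.Binary.PropositionalEquality using (_≡_)
open import Relation.Nullary using (¬_)
open import Function.Bundles using (_⇔_)

-- Points of ℚ^n (ℚ used in place of ℝ).
Point : ℕ → Set
Point n = Fin n → ℚ

sumℚ : ∀ {n} → Point n → ℚ
sumℚ {zero}  x = 0ℚ
sumℚ {suc n} x = x zero + sumℚ (λ i → x (suc i))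

InV : ∀ {n} → Point n → Set
InV x = sumℚ x ≡ 0ℚ

OffArrangement : ∀ {n} → Point n → Set
OffArrangement {n} x = ∀ (i j : Fin n) → i <ᶠ j → ¬ (x i - x j ≡ 1ℚ)

GenericPoint : ℕ → Set
GenericPoint n = Σ (Point n) (λ x → InV x × OffArrangement x)

segment : ∀ {n} → ℚ → Point n → Point n → Point n
segment t x y i = (1ℚ - t) * x i + t * y i

-- Two points of the complement lie in the same region (connected
-- component of the complement) iff the segment joining them avoids
-- every hyperplane (regions are convex).
SameRegion : ∀ {n} → GenericPoint n → GenericPoint n → Set
SameRegion (x , _) (y , _) =
  ∀ (t : ℚ) → 0ℚ ≤ t → t ≤ 1ℚ → OffArrangement (segment t x y)

-- binary relations on {1,…,n} (encoded as Fin n, order preserved)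
Rel : ℕ → Set₁
Rel n = Fin n → Fin n → Set

_≐_ : ∀ {n} → Rel n → Rel n → Set
_≐_ {n} P Q = ∀ (i j : Fin n) → P i j ⇔ Q i j

posetOf : ∀ {n} → Point n → Rel n
posetOf x i j = (i <ᶠ j) × (1ℚ < x i - x j)

IsSemiorder : ∀ {n} → Rel n → Set
IsSemiorder {n} Q = Σ (Point n) (λ y → ∀ (i j : Fin n) → Q i j ⇔ (1ℚ < y j - y i))

IsSleek : ∀ {n} → Rel n → Set₁
IsSleek {n} P = Σ (Rel n) (λ Q → IsSemiorder Q × (∀ (i j : Fin n) → P i j ⇔ (Q i j × i <ᶠ j)))

{-# OPTIONS --safe #-}
module Submission where

-- Along the segment from x to y every difference x i - x j moves affinely, so by the
-- intermediate value property two generic points lie in one region exactly when each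
-- difference x i - x j (i < j) is on the same side of 1 at both ends, i.e. exactly when
-- they define the same poset.  The poset of x is the trace on the chain of the semiorder
-- represented by - x, hence sleek.  Conversely, if y represents a semiorder, take
-- x i = - y i + δ · tilt i with tilt strictly increasing in [0, 1) and δ below every
-- positive gap y j - y i - 1: for i < j this lowers y j - y i by less than δ, keeping it
-- above 1 when it was, and pushing it strictly below 1 otherwise (in particular off the
-- hyperplane when y j - y i = 1).  Centring x then puts it in V.

open import Defs
import Data.Nat as ℕ
open import Data.Nat using (ℕ; zero; suc)
open import Data.Fin using (Fin; zero; suc) renaming (_<_ to _<ᶠ_)
open import Data.Rational
  using (ℚ; 0ℚ; 1ℚ; ½; _+_; _-_; _*_; -_; 1/_; _⊓_; _<_; _≤_; Positive; NonZero; positive; nonNegative)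
open import Data.Rational.Properties
open import Data.Rational.Solver using (module +-*-Solver)
open +-*-Solver using (solve; _:=_; _:+_; _:-_; _:*_; :-_; con)
open import Data.Product using (Σ; ∃-syntax; _×_; _,_; proj₁; proj₂; swap)
open import Data.Sum using (inj₁; inj₂)
open import Data.Empty using (⊥)
open import Function using (_∘_)
open import Function.Bundles using (_⇔_; mk⇔; Equivalence)
open import Relation.Binary.PropositionalEquality
open import Relation.Binary.Definitions using (Tri; tri<; tri≈; tri>)
open import Relation.Nullary using (Dec; yes; no; contradiction)

open Equivalence using (to; from)

p<q⇒0<q-p : ∀ {p q} → p < q → 0ℚ < q - p
p<q⇒0<q-p {p} {q} p<q = subst (_< q - p) (+-inverseʳ p) (+-monoˡ-< (- p) p<q)

p≤q⇒0≤q-p : ∀ {p q} → p ≤ q → 0ℚ ≤ q - p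
p≤q⇒0≤q-p {p} {q} p≤q = subst (_≤ q - p) (+-inverseʳ p) (+-monoˡ-≤ (- p) p≤q)

q-p+p≡q : ∀ p q → q - p + p ≡ q
q-p+p≡q = solve 2 (λ p q → q :- p :+ p := q) refl

0<q-p⇒p<q : ∀ {p q} → 0ℚ < q - p → p < q
0<q-p⇒p<q {p} {q} h = subst₂ _<_ (+-identityˡ p) (q-p+p≡q p q) (+-monoˡ-< p h)

0≤q-p⇒p≤q : ∀ {p q} → 0ℚ ≤ q - p → p ≤ q
0≤q-p⇒p≤q {p} {q} h = subst₂ _≤_ (+-identityˡ p) (q-p+p≡q p q) (+-monoˡ-≤ p h)

q-p<q : ∀ {p q} → 0ℚ < p → q - p < q
q-p<q {p} {q} 0<p = subst (q - p <_) (+-identityʳ q) (+-monoʳ-< q (neg-antimono-< 0<p))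

q-p≤q : ∀ {p q} → 0ℚ ≤ p → q - p ≤ q
q-p≤q {p} {q} 0≤p = subst (q - p ≤_) (+-identityʳ q) (+-monoʳ-≤ q (neg-antimono-≤ 0≤p))

p*1/q*q≡p : ∀ p q .{{_ : NonZero q}} → p * 1/ q * q ≡ p
p*1/q*q≡p p q = begin
  p * 1/ q * q     ≡⟨ *-assoc p (1/ q) q ⟩
  p * (1/ q * q)   ≡⟨ cong (p *_) (*-inverseˡ q) ⟩
  p * 1ℚ           ≡⟨ *-identityʳ p ⟩
  p                ∎
  where open ≡-Reasoning

0≤p*q : ∀ {p q} → 0ℚ ≤ p → 0ℚ ≤ q → 0ℚ ≤ p * q
0≤p*q {p} {q} 0≤p 0≤q =
  nonNegative⁻¹ _ {{nonNeg*nonNeg⇒nonNeg p {{nonNegative 0≤p}} q {{nonNegative 0≤q}}}}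

⊓-glb-< : ∀ {p q r} → r < p → r < q → r < p ⊓ q
⊓-glb-< {p} {q} r<p r<q with ⊓-sel p q
... | inj₁ p⊓q≡p = subst (_ <_) (sym p⊓q≡p) r<p
... | inj₂ p⊓q≡q = subst (_ <_) (sym p⊓q≡q) r<q

interp : ℚ → ℚ → ℚ → ℚ
interp t a b = (1ℚ - t) * a + t * b

interp-swap : ∀ t a b → interp t a b ≡ interp (1ℚ - t) b a
interp-swap = solve 3 (λ t a b →
  (con 1ℚ :- t) :* a :+ t :* b := (con 1ℚ :- (con 1ℚ :- t)) :* b :+ (con 1ℚ :- t) :* a) refl

flip-unitInterval : ∀ {t} → 0ℚ ≤ t → t ≤ 1ℚ → 0ℚ ≤ 1ℚ - t × 1ℚ - t ≤ 1ℚ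
flip-unitInterval {t} 0≤t t≤1 = p≤q⇒0≤q-p t≤1 , 0≤q-p⇒p≤q (subst (0ℚ ≤_) (sym (1-[1-t]≡t t)) 0≤t)
  where
  1-[1-t]≡t : ∀ t → 1ℚ - (1ℚ - t) ≡ t
  1-[1-t]≡t = solve 1 (λ t → con 1ℚ :- (con 1ℚ :- t) := t) refl

interp-between : ∀ {t a b} → a ≤ b → 0ℚ ≤ t → t ≤ 1ℚ → a ≤ interp t a b × interp t a b ≤ b
interp-between {t} {a} {b} a≤b 0≤t t≤1 =
  0≤q-p⇒p≤q (subst (0ℚ ≤_) (sym (above t a b)) (0≤p*q 0≤t (p≤q⇒0≤q-p a≤b))) ,
  0≤q-p⇒p≤q (subst (0ℚ ≤_) (sym (below t a b)) (0≤p*q (p≤q⇒0≤q-p t≤1) (p≤q⇒0≤q-p a≤b)))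
  where
  above : ∀ t a b → interp t a b - a ≡ t * (b - a)
  above = solve 3 (λ t a b → (con 1ℚ :- t) :* a :+ t :* b :- a := t :* (b :- a)) refl
  below : ∀ t a b → b - interp t a b ≡ (1ℚ - t) * (b - a)
  below = solve 3 (λ t a b →
    b :- ((con 1ℚ :- t) :* a :+ t :* b) := (con 1ℚ :- t) :* (b :- a)) refl

interp-between′ : ∀ {t a b} → b ≤ a → 0ℚ ≤ t → t ≤ 1ℚ → b ≤ interp t a b × interp t a b ≤ a
interp-between′ {t} {a} {b} b≤a 0≤t t≤1 =
  subst (λ v → b ≤ v × v ≤ a) (sym (interp-swap t a b))
    (interp-between b≤a (proj₁ (flip-unitInterval 0≤t t≤1)) (proj₂ (flip-unitInterval 0≤t t≤1)))

interp-pres-> : ∀ {t a b c} → 0ℚ ≤ t → t ≤ 1ℚ → c < a → c < b → c < interp t a b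
interp-pres-> {a = a} {b} 0≤t t≤1 c<a c<b with ≤-total a b
... | inj₁ a≤b = <-≤-trans c<a (proj₁ (interp-between a≤b 0≤t t≤1))
... | inj₂ b≤a = <-≤-trans c<b (proj₁ (interp-between′ b≤a 0≤t t≤1))

interp-pres-< : ∀ {t a b c} → 0ℚ ≤ t → t ≤ 1ℚ → a < c → b < c → interp t a b < c
interp-pres-< {a = a} {b} 0≤t t≤1 a<c b<c with ≤-total a b
... | inj₁ a≤b = ≤-<-trans (proj₂ (interp-between a≤b 0≤t t≤1)) b<c
... | inj₂ b≤a = ≤-<-trans (proj₂ (interp-between′ b≤a 0≤t t≤1)) a<c

interp-hits : ∀ {a b c} → c < a → b < c → ∃[ t ] 0ℚ ≤ t × t ≤ 1ℚ × interp t a b ≡ c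
interp-hits {a} {b} {c} c<a b<c = t , 0≤t , t≤1 , hits
  where
  d = a - b
  0<d : 0ℚ < d
  0<d = p<q⇒0<q-p (<-trans b<c c<a)
  instance
    d-pos : Positive d
    d-pos = positive 0<d
    d≢0 : NonZero d
    d≢0 = pos⇒nonZero d
  t = (a - c) * 1/ d
  td≡a-c : t * d ≡ a - c
  td≡a-c = p*1/q*q≡p (a - c) d
  0≤t : 0ℚ ≤ t
  0≤t = *-cancelʳ-≤-pos d (subst₂ _≤_ (sym (*-zeroˡ d)) (sym td≡a-c) (<⇒≤ (p<q⇒0<q-p c<a)))
  t≤1 : t ≤ 1ℚ
  t≤1 = *-cancelʳ-≤-pos d (subst₂ _≤_ (sym td≡a-c) (sym (*-identityˡ d))
          (+-monoʳ-≤ a (neg-antimono-≤ (<⇒≤ b<c))))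
  hits : interp t a b ≡ c
  hits = begin
    interp t a b    ≡⟨ interp-as-shift t a b ⟩
    a - t * d       ≡⟨ cong (λ s → a - s) td≡a-c ⟩
    a - (a - c)     ≡⟨ a-[a-c]≡c a c ⟩
    c               ∎
    where
    open ≡-Reasoning
    interp-as-shift : ∀ t a b → interp t a b ≡ a - t * (a - b)
    interp-as-shift = solve 3 (λ t a b → (con 1ℚ :- t) :* a :+ t :* b := a :- t :* (a :- b)) refl
    a-[a-c]≡c : ∀ a c → a - (a - c) ≡ c
    a-[a-c]≡c = solve 2 (λ a c → a :- (a :- c) := c) refl

Avoids : ℚ → ℚ → ℚ → Set
Avoids c a b = ∀ t → 0ℚ ≤ t → t ≤ 1ℚ → interp t a b ≢ c

avoids-sym : ∀ {a b c} → Avoids c a b → Avoids c b a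
avoids-sym {a} {b} avoids t 0≤t t≤1 hit =
  avoids (1ℚ - t) (proj₁ (flip-unitInterval 0≤t t≤1)) (proj₂ (flip-unitInterval 0≤t t≤1))
         (trans (sym (interp-swap t b a)) hit)

avoids⇒above : ∀ {a b c} → b ≢ c → Avoids c a b → c < a → c < b
avoids⇒above {b = b} {c} b≢c avoids c<a = decide (<-cmp c b)
  where
  decide : Tri (c < b) (c ≡ b) (b < c) → c < b
  decide (tri< c<b _ _) = c<b
  decide (tri≈ _ c≡b _) = contradiction (sym c≡b) b≢c
  decide (tri> _ _ b<c) =
    let (t , 0≤t , t≤1 , hit) = interp-hits c<a b<c in contradiction hit (avoids t 0≤t t≤1)

avoids⇒sameSide : ∀ {a b c} → a ≢ c → b ≢ c → Avoids c a b → (c < a ⇔ c < b)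
avoids⇒sameSide a≢c b≢c avoids =
  mk⇔ (avoids⇒above b≢c avoids) (avoids⇒above a≢c (avoids-sym avoids))

sameSide⇒avoids : ∀ {a b c} → a ≢ c → b ≢ c → (c < a ⇔ c < b) → Avoids c a b
sameSide⇒avoids {a} {b} {c} a≢c b≢c sameSide t 0≤t t≤1 hit = decide (<-cmp c a) (<-cmp c b)
  where
  decide : Tri (c < a) (c ≡ a) (a < c) → Tri (c < b) (c ≡ b) (b < c) → ⊥
  decide (tri≈ _ c≡a _) _              = a≢c (sym c≡a)
  decide _              (tri≈ _ c≡b _) = b≢c (sym c≡b)
  decide (tri< c<a _ _) _              =
    <-irrefl (sym hit) (interp-pres-> 0≤t t≤1 c<a (to sameSide c<a))
  decide (tri> _ _ a<c) (tri< c<b _ _) = <-asym a<c (from sameSide c<b)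
  decide (tri> _ _ a<c) (tri> _ _ b<c) = <-irrefl hit (interp-pres-< 0≤t t≤1 a<c b<c)

segment-diff : ∀ {n} t (x y : Point n) i j →
  segment t x y i - segment t x y j ≡ interp t (x i - x j) (y i - y j)
segment-diff t x y i j = solve 5 (λ t a b c d →
  ((con 1ℚ :- t) :* a :+ t :* c) :- ((con 1ℚ :- t) :* b :+ t :* d)
    := (con 1ℚ :- t) :* (a :- b) :+ t :* (c :- d)) refl t (x i) (x j) (y i) (y j)

sameRegion⇒posetOf-≐ : ∀ {n} (r s : GenericPoint n) → SameRegion r s → posetOf (proj₁ r) ≐ posetOf (proj₁ s)
sameRegion⇒posetOf-≐ (x , _ , x-off) (y , _ , y-off) same i j =
  mk⇔ (λ (i<j , h) → i<j , to (sameSide i<j) h) (λ (i<j , h) → i<j , from (sameSide i<j) h)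
  where
  sameSide : i <ᶠ j → (1ℚ < x i - x j ⇔ 1ℚ < y i - y j)
  sameSide i<j = avoids⇒sameSide (x-off i j i<j) (y-off i j i<j) λ t 0≤t t≤1 hit →
    same t 0≤t t≤1 i j i<j (trans (segment-diff t x y i j) hit)

posetOf-≐⇒sameRegion : ∀ {n} (r s : GenericPoint n) → posetOf (proj₁ r) ≐ posetOf (proj₁ s) → SameRegion r s
posetOf-≐⇒sameRegion (x , _ , x-off) (y , _ , y-off) P≐Q t 0≤t t≤1 i j i<j hit =
  sameSide⇒avoids (x-off i j i<j) (y-off i j i<j) sameSide t 0≤t t≤1
    (trans (sym (segment-diff t x y i j)) hit)
  where
  sameSide : 1ℚ < x i - x j ⇔ 1ℚ < y i - y j
  sameSide = mk⇔ (λ h → proj₂ (to (P≐Q i j) (i<j , h))) (λ h → proj₂ (from (P≐Q i j) (i<j , h)))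

posetOf-isSleek : ∀ {n} (x : Point n) → IsSleek (posetOf x)
posetOf-isSleek x =
    (λ i j → 1ℚ < x i - x j)
  , ((λ i → - x i) , λ i j → mk⇔ (subst (1ℚ <_) (diff-neg i j)) (subst (1ℚ <_) (sym (diff-neg i j))))
  , λ i j → mk⇔ swap swap
  where
  diff-neg : ∀ i j → x i - x j ≡ - x j - - x i
  diff-neg i j = solve 2 (λ a b → a :- b := (:- b) :- (:- a)) refl (x i) (x j)

positiveLowerBound : ∀ {n} (d : Fin n → ℚ) → ∃[ δ ] 0ℚ < δ × (∀ i → 0ℚ < d i → δ ≤ d i)
positiveLowerBound {zero} d = 1ℚ , positive⁻¹ 1ℚ , λ ()
positiveLowerBound {suc n} d with positiveLowerBound (d ∘ suc) | 0ℚ <? d zero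
... | δ , 0<δ , δ≤ | yes 0<d₀ = d zero ⊓ δ , ⊓-glb-< 0<d₀ 0<δ , λ
  { zero    _ → p⊓q≤p (d zero) δ
  ; (suc i) h → p≤q⇒r⊓p≤q (d zero) (δ≤ i h) }
... | δ , 0<δ , δ≤ | no ¬0<d₀ = δ , 0<δ , λ
  { zero    h → contradiction h ¬0<d₀
  ; (suc i) h → δ≤ i h }

gapLowerBound : ∀ {n} (y : Point n) →
  ∃[ δ ] 0ℚ < δ × (∀ i j → 1ℚ < y j - y i → δ ≤ y j - y i - 1ℚ)
gapLowerBound y = fromRows (positiveLowerBound (proj₁ ∘ rowBound))
  where
  rowBound : ∀ i → ∃[ ε ] 0ℚ < ε × (∀ j → 0ℚ < y j - y i - 1ℚ → ε ≤ y j - y i - 1ℚ)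
  rowBound i = positiveLowerBound (λ j → y j - y i - 1ℚ)
  fromRows : (∃[ δ ] 0ℚ < δ × (∀ i → 0ℚ < proj₁ (rowBound i) → δ ≤ proj₁ (rowBound i))) →
             ∃[ δ ] 0ℚ < δ × (∀ i j → 1ℚ < y j - y i → δ ≤ y j - y i - 1ℚ)
  fromRows (δ , 0<δ , δ≤) = δ , 0<δ , λ i j h →
    ≤-trans (δ≤ i (proj₁ (proj₂ (rowBound i)))) (proj₂ (proj₂ (rowBound i)) j (p<q⇒0<q-p h))

tilt : ∀ {n} → Fin n → ℚ
tilt zero    = 0ℚ
tilt (suc i) = ½ + ½ * tilt i

tilt-nonNeg : ∀ {n} (i : Fin n) → 0ℚ ≤ tilt i
tilt-nonNeg zero    = ≤-refl
tilt-nonNeg (suc i) = +-mono-≤ (nonNegative⁻¹ ½) (0≤p*q (nonNegative⁻¹ ½) (tilt-nonNeg i))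

tilt<1 : ∀ {n} (i : Fin n) → tilt i < 1ℚ
tilt<1 zero    = positive⁻¹ 1ℚ
tilt<1 (suc i) = +-monoʳ-< ½ (*-monoʳ-<-pos ½ (tilt<1 i))

tilt-strictMono : ∀ {n} {i j : Fin n} → i <ᶠ j → tilt i < tilt j
tilt-strictMono {i = zero}  {suc j} _ = +-mono-<-≤ (positive⁻¹ ½) (0≤p*q (nonNegative⁻¹ ½) (tilt-nonNeg j))
tilt-strictMono {i = suc i} {suc j} (ℕ.s≤s i<j) = +-monoʳ-< ½ (*-monoʳ-<-pos ½ (tilt-strictMono i<j))

tilt-gap : ∀ {n} {i j : Fin n} → i <ᶠ j → 0ℚ < tilt j - tilt i × tilt j - tilt i < 1ℚ
tilt-gap {i = i} {j} i<j = p<q⇒0<q-p (tilt-strictMono i<j) , ≤-<-trans (q-p≤q (tilt-nonNeg i)) (tilt<1 j)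

smallDecrease-sameSide : ∀ {d e δ} → 0ℚ < e → e < δ → (1ℚ < d → δ ≤ d - 1ℚ) →
  (1ℚ < d - e ⇔ 1ℚ < d) × d - e ≢ 1ℚ
smallDecrease-sameSide {d} {e} 0<e e<δ δ≤d-1 = mk⇔ (λ h → <-trans h (q-p<q 0<e)) staysAbove , avoids1
  where
  staysAbove : 1ℚ < d → 1ℚ < d - e
  staysAbove 1<d = 0<q-p⇒p<q (subst (0ℚ <_) (reorder d e) (p<q⇒0<q-p (<-≤-trans e<δ (δ≤d-1 1<d))))
    where
    reorder : ∀ d e → d - 1ℚ - e ≡ d - e - 1ℚ
    reorder = solve 2 (λ d e → d :- con 1ℚ :- e := d :- e :- con 1ℚ) refl
  decide : Dec (1ℚ < d) → d - e ≢ 1ℚ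
  decide (yes 1<d) hit = <-irrefl (sym hit) (staysAbove 1<d)
  decide (no 1≮d)  hit = <-irrefl hit (<-≤-trans (q-p<q 0<e) (≮⇒≥ 1≮d))
  avoids1 : d - e ≢ 1ℚ
  avoids1 = decide (1ℚ <? d)

cardℚ : ℕ → ℚ
cardℚ n = sumℚ {n} (λ _ → 1ℚ)

sumℚ-nonNeg : ∀ {n} (x : Point n) → (∀ i → 0ℚ ≤ x i) → 0ℚ ≤ sumℚ x
sumℚ-nonNeg {zero}  x _   = ≤-refl
sumℚ-nonNeg {suc n} x 0≤x = +-mono-≤ (0≤x zero) (sumℚ-nonNeg (x ∘ suc) (0≤x ∘ suc))

0<cardℚ-suc : ∀ m → 0ℚ < cardℚ (suc m)
0<cardℚ-suc m = +-mono-<-≤ (positive⁻¹ 1ℚ) (sumℚ-nonNeg {m} (λ _ → 1ℚ) (λ _ → nonNegative⁻¹ 1ℚ))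

cardℚ-suc-nonZero : ∀ m → NonZero (cardℚ (suc m))
cardℚ-suc-nonZero m = pos⇒nonZero (cardℚ (suc m)) {{positive (0<cardℚ-suc m)}}

sumℚ-sub-const : ∀ {n} (x : Point n) c → sumℚ (λ i → x i - c) ≡ sumℚ x - c * cardℚ n
sumℚ-sub-const {zero}  x c = solve 1 (λ c → con 0ℚ := con 0ℚ :- c :* con 0ℚ) refl c
sumℚ-sub-const {suc n} x c = begin
  (x zero - c) + sumℚ (λ i → x (suc i) - c)       ≡⟨ cong (x zero - c +_) (sumℚ-sub-const (x ∘ suc) c) ⟩
  (x zero - c) + (sumℚ (x ∘ suc) - c * cardℚ n)   ≡⟨ regroup (x zero) (sumℚ (x ∘ suc)) c (cardℚ n) ⟩
  (x zero + sumℚ (x ∘ suc)) - c * (1ℚ + cardℚ n)  ∎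
  where
  open ≡-Reasoning
  regroup : ∀ a s c k → (a - c) + (s - c * k) ≡ (a + s) - c * (1ℚ + k)
  regroup = solve 4 (λ a s c k → (a :- c) :+ (s :- c :* k) := (a :+ s) :- c :* (con 1ℚ :+ k)) refl

mean : ∀ {m} → Point (suc m) → ℚ
mean {m} x = sumℚ x * (1/ cardℚ (suc m)) {{cardℚ-suc-nonZero m}}

centre : ∀ {m} → Point (suc m) → Point (suc m)
centre x i = x i - mean x

centre-inV : ∀ {m} (x : Point (suc m)) → InV (centre x)
centre-inV {m} x = begin
  sumℚ (centre x)                    ≡⟨ sumℚ-sub-const x (mean x) ⟩
  sumℚ x - mean x * cardℚ (suc m)    ≡⟨ cong (λ s → sumℚ x - s) mean*card≡sum ⟩
  sumℚ x - sumℚ x                    ≡⟨ +-inverseʳ (sumℚ x) ⟩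
  0ℚ                                 ∎
  where
  open ≡-Reasoning
  mean*card≡sum : mean x * cardℚ (suc m) ≡ sumℚ x
  mean*card≡sum = p*1/q*q≡p (sumℚ x) (cardℚ (suc m)) {{cardℚ-suc-nonZero m}}

centre-diff : ∀ {m} (x : Point (suc m)) i j → centre x i - centre x j ≡ x i - x j
centre-diff x i j = solve 3 (λ a b c → (a :- c) :- (b :- c) := a :- b) refl (x i) (x j) (mean x)

semiorder-realisation : ∀ {m} (y : Point (suc m)) →
  Σ (GenericPoint (suc m)) λ r → ∀ i j → i <ᶠ j → (1ℚ < proj₁ r i - proj₁ r j ⇔ 1ℚ < y j - y i)
semiorder-realisation {m} y = fromGap (gapLowerBound y)
  where
  fromGap : ∃[ δ ] 0ℚ < δ × (∀ i j → 1ℚ < y j - y i → δ ≤ y j - y i - 1ℚ) →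
    Σ (GenericPoint (suc m)) λ r → ∀ i j → i <ᶠ j → (1ℚ < proj₁ r i - proj₁ r j ⇔ 1ℚ < y j - y i)
  fromGap (δ , 0<δ , δ≤gap) =
    (x , centre-inV x₀ , λ i j i<j → proj₂ (sides i j i<j)) , λ i j i<j → proj₁ (sides i j i<j)
    where
    x₀ x : Point (suc m)
    x₀ i = - y i + δ * tilt i
    x = centre x₀
    diff : ∀ i j → x i - x j ≡ (y j - y i) - δ * (tilt j - tilt i)
    diff i j = trans (centre-diff x₀ i j) (solve 5 (λ a b d u v →
      (:- a :+ d :* u) :- (:- b :+ d :* v) := (b :- a) :- d :* (v :- u)) refl (y i) (y j) δ (tilt i) (tilt j))
    sides : ∀ i j → i <ᶠ j → (1ℚ < x i - x j ⇔ 1ℚ < y j - y i) × x i - x j ≢ 1ℚ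
    sides i j i<j = subst (λ v → (1ℚ < v ⇔ 1ℚ < y j - y i) × v ≢ 1ℚ) (sym (diff i j))
      (smallDecrease-sameSide δtilt>0 δtilt<δ (δ≤gap i j))
      where
      instance
        δ-pos : Positive δ
        δ-pos = positive 0<δ
      δtilt>0 : 0ℚ < δ * (tilt j - tilt i)
      δtilt>0 = subst (_< δ * (tilt j - tilt i)) (*-zeroʳ δ) (*-monoʳ-<-pos δ (proj₁ (tilt-gap i<j)))
      δtilt<δ : δ * (tilt j - tilt i) < δ
      δtilt<δ = subst (δ * (tilt j - tilt i) <_) (*-identityʳ δ) (*-monoʳ-<-pos δ (proj₂ (tilt-gap i<j)))

sleek-realisation : ∀ {m} (P : Rel (suc m)) → IsSleek P →
  Σ (GenericPoint (suc m)) (λ r → posetOf (proj₁ r) ≐ P)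
sleek-realisation {m} P (Q , (y , Q⇔) , P⇔) = r , λ i j → mk⇔
  (λ (i<j , h) → from (P⇔ i j) (from (Q⇔ i j) (to (sides i j i<j) h) , i<j))
  (λ p → let (q , i<j) = to (P⇔ i j) p in i<j , from (sides i j i<j) (to (Q⇔ i j) q))
  where
  r : GenericPoint (suc m)
  r = proj₁ (semiorder-realisation y)
  sides : ∀ i j → i <ᶠ j → (1ℚ < proj₁ r i - proj₁ r j ⇔ 1ℚ < y j - y i)
  sides = proj₂ (semiorder-realisation y)

proposition8p3 : (n : ℕ) → 1 ℕ.≤ n →
    -- R ↦ P(R) is well defined (independent of the chosen point of R)
    ((r s : GenericPoint n) → SameRegion r s → posetOf (proj₁ r) ≐ posetOf (proj₁ s))
    -- P(R) is sleek
    × ((r : GenericPoint n) → IsSleek (posetOf (proj₁ r)))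
    -- injective on regions
    × ((r s : GenericPoint n) → posetOf (proj₁ r) ≐ posetOf (proj₁ s) → SameRegion r s)
    -- surjective onto sleek posets
    × ((P : Rel n) → IsSleek P → Σ (GenericPoint n) (λ r → posetOf (proj₁ r) ≐ P))
proposition8p3 (suc m) _ =
  sameRegion⇒posetOf-≐ , posetOf-isSleek ∘ proj₁ , posetOf-≐⇒sameRegion , sleek-realisation
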